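{- Let $l\ge 0$ be an integer, let $\tilde n=2^{2^l}$ (so $\log_2\tilde n=2^l$), let $n=\frac{\tilde n}{\log_2\tilde n}+1$ and $m=n+l$. Let $c=(c_{i,j})_{1\le i\le m,\,1\le j\le n}$ be the cost matrix defined by: for $1\le i\le n$, $$c_{i,j}=\begin{cases}1 & \text{if } i=j,\\ 1-\dfrac{(i-j)\log_2\tilde n}{2(\tilde n-j+1)} & \text{if } i>j,\\ \infty & \text{if } i<j,\end{cases}$$ and for $n<i\le n+l$, $c_{i,j}=2^{i-n}$ for every $j$. Let $a$ be any allocation of the $n$ jobs to the $m$ machines (each job assigned to exactly one machine) whose makespan is less than $2^l=\log_2\tilde n$. Then: (1) fewer than $2^{l+1}$ jobs are assigned to each machine; (2) for each $i$ with $n<i\le n+l$, fewer than $2^l/2^{i-n}$ jobs are assigned to machine $i$; (3) the total number of jobs assigned to machines $n+1,\dots,n+l$ is fewer than $2^l$.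
   Context: Logarithms are base $2$; $\infty$ denotes an infinite cost, larger than every real number (a sum containing $\infty$ equals $\infty$). An allocation is a $0/1$ matrix $(a_{i,j})$ with $\sum_{i=1}^m a_{i,j}=1$ for every job $j$; $a_{i,j}=1$ means job $j$ runs on machine $i$. The load of machine $i$ is $\sum_{j=1}^n c_{i,j}a_{i,j}$, and the makespan of $a$ is the maximum load over all machines. -}

module Defs where

open import Data.Nat as ℕ using (ℕ; zero; suc; _∸_; _^_; NonZero)
open import Data.Nat.Properties using (m^n≢0; m*n≢0)
import Data.Nat.DivMod as ℕDiv
open import Data.Fin using (Fin; toℕ; zero; suc)
open import Data.Integer using (+_)
open import Data.Rational as ℚ using (ℚ; 1ℚ; 0ℚ)
open import Data.Unit using (⊤)
open import Data.Empty using (⊥)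
open import Data.Sum using (_⊎_)
open import Data.Product using (_×_)
open import Relation.Binary.PropositionalEquality using (_≡_)
open import Relation.Nullary using (yes; no)

Σℕ : (k : ℕ) → (Fin k → ℕ) → ℕ
Σℕ zero    f = 0
Σℕ (suc k) f = f zero ℕ.+ Σℕ k (λ x → f (suc x))

data Cost : Set where
  fin : ℚ → Cost
  ∞   : Cost

_+ᶜ_ : Cost → Cost → Cost
fin p +ᶜ fin q = fin (p ℚ.+ q)
fin _ +ᶜ ∞     = ∞
∞     +ᶜ _     = ∞

-- c * a for an allocation entry a ∈ {0,1} (convention: ∞ · 0 = 0)
_*ᶜ_ : Cost → ℕ → Cost
fin p *ᶜ a     = fin (p ℚ.* (+ a ℚ./ 1))
∞     *ᶜ zero  = fin 0ℚ
∞     *ᶜ suc _ = ∞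

_<ᶜ_ : Cost → Cost → Set
fin p <ᶜ fin q = p ℚ.< q
fin _ <ᶜ ∞     = ⊤
∞     <ᶜ _     = ⊥

_⊔ᶜ_ : Cost → Cost → Cost
fin p ⊔ᶜ fin q = fin (p ℚ.⊔ q)
fin _ ⊔ᶜ ∞     = ∞
∞     ⊔ᶜ _     = ∞

Σᶜ : (k : ℕ) → (Fin k → Cost) → Cost
Σᶜ zero    f = fin 0ℚ
Σᶜ (suc k) f = f zero +ᶜ Σᶜ k (λ x → f (suc x))

Maxᶜ : (k : ℕ) → (Fin k → Cost) → Cost
Maxᶜ zero    f = fin 0ℚ
Maxᶜ (suc k) f = f zero ⊔ᶜ Maxᶜ k (λ x → f (suc x))

IsAllocation : (m n : ℕ) → (Fin m → Fin n → ℕ) → Set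
IsAllocation m n a =
  ((i : Fin m) (j : Fin n) → (a i j ≡ 0) ⊎ (a i j ≡ 1)) ×
  ((j : Fin n) → Σℕ m (λ i → a i j) ≡ 1)

load : (m n : ℕ) → (Fin m → Fin n → Cost) → (Fin m → Fin n → ℕ) → Fin m → Cost
load m n c a i = Σᶜ n (λ j → c i j *ᶜ a i j)

makespan : (m n : ℕ) → (Fin m → Fin n → Cost) → (Fin m → Fin n → ℕ) → Cost
makespan m n c a = Maxᶜ m (load m n c a)

jobsOn : (m n : ℕ) → (Fin m → Fin n → ℕ) → Fin m → ℕ
jobsOn m n a i = Σℕ n (a i)

ñ : ℕ → ℕ
ñ l = 2 ^ (2 ^ l)

logñ : ℕ → ℕ
logñ l = 2 ^ l

nJobs : ℕ → ℕ
nJobs l = ℕDiv._/_ (ñ l) (logñ l) {{m^n≢0 2 l}} ℕ.+ 1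

mMachines : ℕ → ℕ
mMachines l = nJobs l ℕ.+ l

-- The cost matrix, with 0-based indices: machine i ↔ i+1, job j ↔ j+1 of the paper.
-- For i > j (paper: (i-j) log ñ / (2 (ñ - j + 1)), paper j = j'+1, so ñ - j + 1 = ñ - j').
-- The denominator is written 2 * suc (ñ ∸ suc j'), which equals 2 (ñ - j') whenever j' < ñ,
-- which holds in this branch (j' ≤ n - 2 < ñ).
costFin : (l : ℕ) → ℕ → ℕ → Cost
costFin l i j with i ℕ.<? nJobs l
... | no _ = fin (+ (2 ^ (suc i ∸ nJobs l)) ℚ./ 1)
... | yes _ with ℕ.compare i j
...   | ℕ.less _ _    = ∞
...   | ℕ.equal _     = fin 1ℚ
...   | ℕ.greater _ _ = fin (1ℚ ℚ.- ((+ ((i ∸ j) ℕ.* logñ l)) ℚ./ (2 ℕ.* suc (ñ l ∸ suc j))) {{m*n≢0 2 (suc (ñ l ∸ suc j))}})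

cost : (l : ℕ) → Fin (mMachines l) → Fin (nJobs l) → Cost
cost l i j = costFin l (toℕ i) (toℕ j)

-- Every finite entry of the cost matrix is at least 1/2: the off-diagonal
-- deficit (i - j) log ñ / (2 (ñ - j + 1)) is at most 1/2 because
-- i ≤ ñ / log ñ. Hence a machine carrying k jobs has load at least k/2, and
-- an extra machine n + t, whose entries all equal 2^t, has load 2^t k.
-- Comparing with the makespan bound 2^l gives (1) and (2), and (3) follows
-- from (2) by summing the geometric series 2^(l-1) + ... + 1 < 2^l.
module Submission where

open import Defs
open import Data.Nat using (ℕ; suc; _<_; _≤_; _∸_; _^_)
open import Data.Nat.Properties using (m^n≢0)
import Data.Nat.DivMod
open import Data.Fin using (Fin; toℕ; _↑ʳ_)
open import Data.Integer using (+_)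
import Data.Rational
open import Data.Product using (_×_)

open import Data.Nat as ℕ using (zero; z≤n; s≤s)
import Data.Nat.Properties as ℕP
import Data.Nat.DivMod as ℕDiv
open import Data.Fin using (zero; suc)
import Data.Fin.Properties as FinP
import Data.Integer as ℤ
import Data.Integer.Properties as ℤP
open import Data.Integer.Solver using (module +-*-Solver)
import Data.Rational as ℚ
import Data.Rational.Properties as ℚP
open import Data.Rational.Unnormalised as ℚᵘ using (mkℚᵘ; *≤*; *<*)
import Data.Rational.Unnormalised.Properties as ℚᵘP
open import Data.Unit using (⊤; tt)
open import Data.Empty using (⊥-elim)
open import Data.Sum using (_⊎_; inj₁; inj₂)
open import Data.Product using (_,_; proj₁; proj₂)
open import Relation.Nullary using (yes; no)
open import Relation.Binary.PropositionalEquality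

Σℕ-distribʳ-* : ∀ k (f : Fin k → ℕ) c → Σℕ k (λ j → f j ℕ.* c) ≡ Σℕ k f ℕ.* c
Σℕ-distribʳ-* zero    f c = refl
Σℕ-distribʳ-* (suc k) f c = begin
  f zero ℕ.* c ℕ.+ Σℕ k (λ j → f (suc j) ℕ.* c) ≡⟨ cong (f zero ℕ.* c ℕ.+_) (Σℕ-distribʳ-* k (λ j → f (suc j)) c) ⟩
  f zero ℕ.* c ℕ.+ Σℕ k (λ j → f (suc j)) ℕ.* c ≡⟨ ℕP.*-distribʳ-+ c (f zero) _ ⟨
  Σℕ (suc k) f ℕ.* c                            ∎
  where open ≡-Reasoning

Σℕ-<-geometric : ∀ l (f : Fin l → ℕ) → (∀ k → f k < 2 ^ (l ∸ suc (toℕ k))) → Σℕ l f < 2 ^ l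
Σℕ-<-geometric zero    f f< = s≤s z≤n
Σℕ-<-geometric (suc l) f f< = ℕP.<-≤-trans
  (ℕP.+-mono-< (f< zero) (Σℕ-<-geometric l (λ k → f (suc k)) (λ k → f< (suc k))))
  (ℕP.+-monoʳ-≤ (2 ^ l) (ℕP.m≤m+n (2 ^ l) 0))

2^[l∸k]*2^k≡2^l : ∀ {k l} → k ≤ l → 2 ^ (l ∸ k) ℕ.* 2 ^ k ≡ 2 ^ l
2^[l∸k]*2^k≡2^l {k} {l} k≤l =
  trans (sym (ℕP.^-distribˡ-+-* 2 (l ∸ k) k)) (cong (2 ^_) (ℕP.m∸n+n≡m k≤l))

2^l/2^k≡2^[l∸k] : ∀ {k l} → k ≤ l → ℕDiv._/_ (2 ^ l) (2 ^ k) {{m^n≢0 2 k}} ≡ 2 ^ (l ∸ k)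
2^l/2^k≡2^[l∸k] {k} {l} k≤l =
  trans (cong (λ z → ℕDiv._/_ z (2 ^ k) {{m^n≢0 2 k}}) (sym (2^[l∸k]*2^k≡2^l k≤l)))
        (ℕDiv.m*n/n≡m (2 ^ (l ∸ k)) (2 ^ k) {{m^n≢0 2 k}})

*2^k<2^l⇒<2^[l∸k] : ∀ x {k l} → k ≤ l → x ℕ.* 2 ^ k < 2 ^ l → x < 2 ^ (l ∸ k)
*2^k<2^l⇒<2^[l∸k] x {k} k≤l x*2^k<2^l =
  ℕP.*-cancelʳ-< (2 ^ k) x _ (subst (x ℕ.* 2 ^ k <_) (sym (2^[l∸k]*2^k≡2^l k≤l)) x*2^k<2^l)

⊔ᶜ<ᶜfin⇒<ᶜfin : ∀ x y q → (x ⊔ᶜ y) <ᶜ fin q → (x <ᶜ fin q) × (y <ᶜ fin q)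
⊔ᶜ<ᶜfin⇒<ᶜfin (fin p) (fin r) q p⊔r<q =
  ℚP.≤-<-trans (ℚP.p≤p⊔q p r) p⊔r<q , ℚP.≤-<-trans (ℚP.p≤q⊔p p r) p⊔r<q

Maxᶜ<ᶜfin⇒<ᶜfin : ∀ k (f : Fin k → Cost) q → Maxᶜ k f <ᶜ fin q → ∀ i → f i <ᶜ fin q
Maxᶜ<ᶜfin⇒<ᶜfin (suc k) f q max<q zero    = proj₁ (⊔ᶜ<ᶜfin⇒<ᶜfin (f zero) _ q max<q)
Maxᶜ<ᶜfin⇒<ᶜfin (suc k) f q max<q (suc i) =
  Maxᶜ<ᶜfin⇒<ᶜfin k (λ x → f (suc x)) q (proj₂ (⊔ᶜ<ᶜfin⇒<ᶜfin (f zero) _ q max<q)) i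

-- x / (1 + d) ≤ C, with a fixed denominator so that lower bounds of summed
-- costs add up in the numerator.
infix 4 _/1+_≤ᶜ_
_/1+_≤ᶜ_ : ℕ → ℕ → Cost → Set
x /1+ d ≤ᶜ fin p = mkℚᵘ (+ x) d ℚᵘ.≤ ℚ.toℚᵘ p
x /1+ d ≤ᶜ ∞     = ⊤

mkℚᵘ-+ : ∀ d x y → mkℚᵘ (+ (x ℕ.+ y)) d ℚᵘ.≃ mkℚᵘ (+ x) d ℚᵘ.+ mkℚᵘ (+ y) d
mkℚᵘ-+ d x y = ℚᵘ.*≡* (trans
  (cong (ℤ._* ℚᵘ.↧ (mkℚᵘ (+ x) d ℚᵘ.+ mkℚᵘ (+ y) d)) (ℤP.pos-+ x y))
  (distrib (+ x) (+ y) ℤ.+[1+ d ]))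
  where
  open +-*-Solver
  distrib : ∀ X Y D → (X ℤ.+ Y) ℤ.* (D ℤ.* D) ≡ (X ℤ.* D ℤ.+ Y ℤ.* D) ℤ.* D
  distrib = solve 3 (λ X Y D → (X :+ Y) :* (D :* D) := (X :* D :+ Y :* D) :* D) refl

/1+≤ᶜ-+ᶜ : ∀ {d x y} A B → x /1+ d ≤ᶜ A → y /1+ d ≤ᶜ B → x ℕ.+ y /1+ d ≤ᶜ A +ᶜ B
/1+≤ᶜ-+ᶜ {d} {x} {y} (fin p) (fin q) x≤p y≤q =
  ℚᵘP.≤-respʳ-≃ (ℚᵘP.≃-sym (ℚP.toℚᵘ-homo-+ p q))
    (ℚᵘP.≤-respˡ-≃ (ℚᵘP.≃-sym (mkℚᵘ-+ d x y)) (ℚᵘP.+-mono-≤ x≤p y≤q))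
/1+≤ᶜ-+ᶜ (fin p) ∞ _ _ = tt
/1+≤ᶜ-+ᶜ ∞       B _ _ = tt

/1+≤ᶜ-Σᶜ : ∀ {d} k (f : Fin k → Cost) (x : Fin k → ℕ) →
           (∀ j → x j /1+ d ≤ᶜ f j) → Σℕ k x /1+ d ≤ᶜ Σᶜ k f
/1+≤ᶜ-Σᶜ zero    f x x≤f = *≤* (ℤ.+≤+ z≤n)
/1+≤ᶜ-Σᶜ (suc k) f x x≤f = /1+≤ᶜ-+ᶜ (f zero) _ (x≤f zero)
  (/1+≤ᶜ-Σᶜ k (λ j → f (suc j)) (λ j → x (suc j)) (λ j → x≤f (suc j)))

/1+≤ᶜ-*ᶜ : ∀ {d x} C a → (a ≡ 0) ⊎ (a ≡ 1) → x /1+ d ≤ᶜ C → a ℕ.* x /1+ d ≤ᶜ C *ᶜ a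
/1+≤ᶜ-*ᶜ (fin p) _ (inj₁ refl) _ rewrite ℚP.*-zeroʳ p = *≤* (ℤ.+≤+ z≤n)
/1+≤ᶜ-*ᶜ ∞       _ (inj₁ refl) _ = *≤* (ℤ.+≤+ z≤n)
/1+≤ᶜ-*ᶜ {x = x} (fin p) _ (inj₂ refl) x≤p
  rewrite ℚP.*-identityʳ p | ℕP.+-identityʳ x = x≤p
/1+≤ᶜ-*ᶜ ∞       _ (inj₂ refl) _ = tt

/1+≤ᶜ-load : ∀ {d x} m n c a (i : Fin m) → (∀ j → (a i j ≡ 0) ⊎ (a i j ≡ 1)) →
             (∀ j → x /1+ d ≤ᶜ c i j) → jobsOn m n a i ℕ.* x /1+ d ≤ᶜ load m n c a i
/1+≤ᶜ-load {d} {x} m n c a i a-01 x≤c =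
  subst (_/1+ d ≤ᶜ load m n c a i) (Σℕ-distribʳ-* n (a i) x)
    (/1+≤ᶜ-Σᶜ n _ _ (λ j → /1+≤ᶜ-*ᶜ (c i j) (a i j) (a-01 j) (x≤c j)))

toℚᵘ[n/1]≃n : ∀ n → ℚ.toℚᵘ (+ n ℚ./ 1) ℚᵘ.≃ mkℚᵘ (+ n) 0
toℚᵘ[n/1]≃n n = ℚP.toℚᵘ-fromℚᵘ (mkℚᵘ (+ n) 0)

/1+≤ᶜ-<ᶜ⇒< : ∀ {d x} C L → x /1+ d ≤ᶜ C → C <ᶜ fin (+ L ℚ./ 1) → x < L ℕ.* suc d
/1+≤ᶜ-<ᶜ⇒< {d} {x} (fin p) L x≤p p<L
  with ℚᵘP.≤-<-trans x≤p (ℚᵘP.<-respʳ-≃ (toℚᵘ[n/1]≃n L) (ℚP.toℚᵘ-mono-< p<L))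
... | *<* x*1<L*[1+d] with subst₂ ℤ._<_ (sym (ℤP.pos-* x 1)) (sym (ℤP.pos-* L (suc d))) x*1<L*[1+d]
...   | ℤ.+<+ lt = subst (_< L ℕ.* suc d) (ℕP.*-identityʳ x) lt

½≤1-A/[2[1+m]] : ∀ A m → A ≤ suc m →
                 1 /1+ 1 ≤ᶜ fin (ℚ.1ℚ ℚ.- (+ A ℚ./ (2 ℕ.* suc m)))
½≤1-A/[2[1+m]] A m A≤1+m = begin
  ½                 ≤⟨ ℚᵘP.≤-reflexive (ℚᵘ.*≡* refl) ⟩
  ℚᵘ.1ℚᵘ ℚᵘ.- ½     ≤⟨ ℚᵘP.+-monoʳ-≤ ℚᵘ.1ℚᵘ (ℚᵘP.neg-mono-≤ X≤½) ⟩
  ℚᵘ.1ℚᵘ ℚᵘ.- X     ≃⟨ toℚᵘ-1-X ⟨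
  ℚ.toℚᵘ (ℚ.1ℚ ℚ.- (+ A ℚ./ B)) ∎
  where
  open ℚᵘP.≤-Reasoning
  B = 2 ℕ.* suc m
  ½ = mkℚᵘ (+ 1) 1
  X = mkℚᵘ (+ A) (ℕ.pred B)
  toℚᵘ-1-X : ℚ.toℚᵘ (ℚ.1ℚ ℚ.- (+ A ℚ./ B)) ℚᵘ.≃ ℚᵘ.1ℚᵘ ℚᵘ.- X
  toℚᵘ-1-X = ℚᵘP.≃-trans (ℚP.toℚᵘ-homo-+ ℚ.1ℚ (ℚ.- (+ A ℚ./ B)))
    (ℚᵘP.+-congʳ ℚᵘ.1ℚᵘ (ℚᵘP.≃-trans (ℚP.toℚᵘ-homo‿- (+ A ℚ./ B)) (ℚᵘP.-‿cong (ℚP.toℚᵘ-fromℚᵘ X))))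
  X≤½ : X ℚᵘ.≤ ½
  X≤½ = *≤* (subst₂ ℤ._≤_ (ℤP.pos-* A 2) (ℤP.pos-* 1 B) (ℤ.+≤+ A*2≤1*B))
    where
    A*2≤1*B : A ℕ.* 2 ≤ 1 ℕ.* B
    A*2≤1*B = subst (A ℕ.* 2 ≤_) (trans (ℕP.*-comm (suc m) 2) (sym (ℕP.*-identityˡ B)))
                (ℕP.*-monoˡ-≤ 2 A≤1+m)

m∸n≤1+[m∸1+n] : ∀ m n → m ∸ n ≤ suc (m ∸ suc n)
m∸n≤1+[m∸1+n] zero    zero    = z≤n
m∸n≤1+[m∸1+n] zero    (suc n) = z≤n
m∸n≤1+[m∸1+n] (suc m) zero    = ℕP.≤-refl
m∸n≤1+[m∸1+n] (suc m) (suc n) = m∸n≤1+[m∸1+n] m n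

<nJobs⇒*logñ≤ñ : ∀ l {i} → i < nJobs l → i ℕ.* logñ l ≤ ñ l
<nJobs⇒*logñ≤ñ l {i} i<n = ℕP.≤-trans
  (ℕP.*-monoˡ-≤ (logñ l) (ℕP.m<1+n⇒m≤n (subst (i <_) (ℕP.+-comm _ 1) i<n)))
  (ℕDiv.m/n*n≤m (ñ l) (logñ l) {{m^n≢0 2 l}})

-- In the paper's 1-based indexing: (i - j) log ñ ≤ ñ - j + 1.
<nJobs⇒[i∸j]*logñ≤1+[ñ∸1+j] : ∀ l {i} j → i < nJobs l → (i ∸ j) ℕ.* logñ l ≤ suc (ñ l ∸ suc j)
<nJobs⇒[i∸j]*logñ≤1+[ñ∸1+j] l {i} j i<n = begin
  (i ∸ j) ℕ.* L           ≡⟨ ℕP.*-distribʳ-∸ L i j ⟩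
  i ℕ.* L ∸ j ℕ.* L       ≤⟨ ℕP.∸-monoˡ-≤ (j ℕ.* L) (<nJobs⇒*logñ≤ñ l i<n) ⟩
  ñ l ∸ j ℕ.* L           ≤⟨ ℕP.∸-monoʳ-≤ (ñ l) (ℕP.m≤m*n j L {{m^n≢0 2 l}}) ⟩
  ñ l ∸ j                 ≤⟨ m∸n≤1+[m∸1+n] (ñ l) j ⟩
  suc (ñ l ∸ suc j)       ∎
  where
  open ℕP.≤-Reasoning
  L = logñ l

costFin≥½ : ∀ l i j → 1 /1+ 1 ≤ᶜ costFin l i j
costFin≥½ l i j with i ℕ.<? nJobs l
... | no _ = ℚᵘP.≤-respʳ-≃ (ℚᵘP.≃-sym (toℚᵘ[n/1]≃n P))
  (*≤* (subst₂ ℤ._≤_ (ℤP.pos-* 1 1) (ℤP.pos-* P 2) (ℤ.+≤+ (ℕP.m≤n⇒m≤n*o 2 (ℕP.m^n>0 2 (suc i ∸ nJobs l))))))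
  where P = 2 ^ (suc i ∸ nJobs l)
... | yes i<n with ℕ.compare i j
...   | ℕ.less _ _    = tt
...   | ℕ.equal _     = *≤* (ℤ.+≤+ (s≤s z≤n))
...   | ℕ.greater _ _ = ½≤1-A/[2[1+m]] _ _ (<nJobs⇒[i∸j]*logñ≤1+[ñ∸1+j] l j i<n)

costFin≥2^[1+i∸nJobs] : ∀ l i j → nJobs l ≤ i → 2 ^ (suc i ∸ nJobs l) /1+ 0 ≤ᶜ costFin l i j
costFin≥2^[1+i∸nJobs] l i j n≤i with i ℕ.<? nJobs l
... | yes i<n = ⊥-elim (ℕP.<⇒≱ i<n n≤i)
... | no _    = ℚᵘP.≤-reflexive (ℚᵘP.≃-sym (toℚᵘ[n/1]≃n (2 ^ (suc i ∸ nJobs l))))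

1+toℕ[n↑ʳk]∸n≡1+toℕk : ∀ {m} n (k : Fin m) → suc (toℕ (n ↑ʳ k)) ∸ n ≡ suc (toℕ k)
1+toℕ[n↑ʳk]∸n≡1+toℕk n k = begin
  suc (toℕ (n ↑ʳ k)) ∸ n   ≡⟨ cong (λ z → suc z ∸ n) (FinP.toℕ-↑ʳ n k) ⟩
  suc (n ℕ.+ toℕ k) ∸ n    ≡⟨ cong (_∸ n) (ℕP.+-suc n (toℕ k)) ⟨
  n ℕ.+ suc (toℕ k) ∸ n    ≡⟨ ℕP.m+n∸m≡n n (suc (toℕ k)) ⟩
  suc (toℕ k)              ∎
  where open ≡-Reasoning

lemma2 : (l : ℕ) (a : Fin (mMachines l) → Fin (nJobs l) → ℕ)
    → IsAllocation (mMachines l) (nJobs l) a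
    → makespan (mMachines l) (nJobs l) (cost l) a <ᶜ fin ((+ (2 ^ l)) Data.Rational./ 1)
    → ((i : Fin (mMachines l)) → jobsOn (mMachines l) (nJobs l) a i < 2 ^ suc l)
      × ((i : Fin (mMachines l)) → nJobs l ≤ toℕ i
          → jobsOn (mMachines l) (nJobs l) a i
            < Data.Nat.DivMod._/_ (2 ^ l) (2 ^ (suc (toℕ i) ∸ nJobs l)) {{m^n≢0 2 (suc (toℕ i) ∸ nJobs l)}})
      × (Σℕ l (λ k → jobsOn (mMachines l) (nJobs l) a (nJobs l ↑ʳ k)) < 2 ^ l)
lemma2 l a (a-01 , _) makespan<2^l = jobs<2^[1+l] , jobs<2^l/2^k , Σextra<2^l
  where
  n = nJobs l
  jobs = jobsOn (mMachines l) n a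
  k≤l : ∀ i → suc (toℕ i) ∸ n ≤ l
  k≤l i = subst (suc (toℕ i) ∸ n ≤_) (ℕP.m+n∸m≡n n l) (ℕP.∸-monoˡ-≤ n (FinP.toℕ<n i))

  load<2^l : ∀ i → load (mMachines l) n (cost l) a i <ᶜ fin (+ 2 ^ l ℚ./ 1)
  load<2^l = Maxᶜ<ᶜfin⇒<ᶜfin (mMachines l) _ _ makespan<2^l

  jobs<2^[1+l] : ∀ i → jobs i < 2 ^ suc l
  jobs<2^[1+l] i = subst₂ _<_ (ℕP.*-identityʳ (jobs i)) (ℕP.*-comm (2 ^ l) 2)
    (/1+≤ᶜ-<ᶜ⇒< _ (2 ^ l)
      (/1+≤ᶜ-load _ n (cost l) a i (a-01 i) (λ j → costFin≥½ l (toℕ i) (toℕ j))) (load<2^l i))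

  jobs<2^[l∸k] : ∀ i → n ≤ toℕ i → jobs i < 2 ^ (l ∸ (suc (toℕ i) ∸ n))
  jobs<2^[l∸k] i n≤i = *2^k<2^l⇒<2^[l∸k] (jobs i) (k≤l i)
    (subst (jobs i ℕ.* 2 ^ (suc (toℕ i) ∸ n) <_) (ℕP.*-identityʳ (2 ^ l)) (/1+≤ᶜ-<ᶜ⇒< _ (2 ^ l)
      (/1+≤ᶜ-load _ n (cost l) a i (a-01 i) (λ j → costFin≥2^[1+i∸nJobs] l (toℕ i) (toℕ j) n≤i)) (load<2^l i)))

  jobs<2^l/2^k : ∀ i → n ≤ toℕ i
    → jobs i < ℕDiv._/_ (2 ^ l) (2 ^ (suc (toℕ i) ∸ n)) {{m^n≢0 2 (suc (toℕ i) ∸ n)}}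
  jobs<2^l/2^k i n≤i = subst (jobs i <_) (sym (2^l/2^k≡2^[l∸k] (k≤l i))) (jobs<2^[l∸k] i n≤i)

  Σextra<2^l : Σℕ l (λ k → jobs (n ↑ʳ k)) < 2 ^ l
  Σextra<2^l = Σℕ-<-geometric l _ λ k →
    subst (λ e → jobs (n ↑ʳ k) < 2 ^ (l ∸ e)) (1+toℕ[n↑ʳk]∸n≡1+toℕk n k)
      (jobs<2^[l∸k] (n ↑ʳ k) (subst (n ≤_) (sym (FinP.toℕ-↑ʳ n k)) (ℕP.m≤m+n n (toℕ k))))
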